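{- Fix an integer $0\leq a\leq b-1$ and let $N\ge1$ be an integer with $N\geq N_{a,A}+N_{b-a,b-A}$. If $n$ is an integer with $0 \leq n\leq Nb$, $n\equiv a \pmod b$ and $n\notin \mathcal E(A)\cup (Nb- \mathcal E(b-A))$, then $n\in NA$.
   Context: $A$ is a finite set of integers with smallest element $0$, largest element $b\ge1$, and gcd of its elements equal to $1$. $\mathbb N=\{0,1,2,\dots\}$. For an integer $N\ge1$, $NA=\{a_1+\cdots+a_N:a_i\in A\}$ (repetitions allowed), and $0A=\{0\}$. For a finite set $X$ of nonnegative integers, $\mathcal P(X)=\{\sum_{x\in X} n_x x: n_x\in\mathbb N\}$ and $\mathcal E(X)=\mathbb N\setminus\mathcal P(X)$. $b-A=\{b-x:x\in A\}$; $m-Y=\{m-y:y\in Y\}$. For an integer $c$, $n_{c,A}=\min\{n\ge 0: n\equiv c\pmod b,\ n\in\mathcal P(A)\}$ and $N_{c,A}=\min\{N\ge0: n_{c,A}\in NA\}$; $n_{c,b-A}$, $N_{c,b-A}$ are defined likewise with $b-A$ in place of $A$ (same modulus $b$). -}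

module Defs where

open import Data.Nat using (ℕ; zero; suc; _+_; _*_; _∸_; _≤_; _<_; NonZero)
open import Data.Nat.DivMod using (_%_)
open import Data.Nat.GCD using (gcd)
open import Data.List using (List; []; _∷_; map; foldr; length)
open import Data.Vec using (Vec; fromList; zipWith)
import Data.Vec as V
open import Data.Vec.Relation.Unary.All using (All)
open import Data.List.Membership.Propositional using (_∈_)
open import Data.Product using (Σ; _×_; ∃)
open import Relation.Binary.PropositionalEquality using (_≡_)
open import Relation.Nullary using (¬_)

-- A finite set of (nonnegative) integers is represented by a list of naturals.

gcdList : List ℕ → ℕ
gcdList = foldr gcd 0

InSumset : List ℕ → ℕ → ℕ → Set
InSumset A N n = Σ (Vec ℕ N) λ v → All (_∈ A) v × V.sum v ≡ n

InP : List ℕ → ℕ → Set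
InP X n = Σ (Vec ℕ (length X)) λ c → V.sum (zipWith _*_ c (fromList X)) ≡ n

InE : List ℕ → ℕ → Set
InE X n = ¬ InP X n

-- b - X = { b - x : x ∈ X }  (used only when all x ≤ b)
minusSet : ℕ → List ℕ → List ℕ
minusSet b X = map (b ∸_) X

InReflectE : ℕ → List ℕ → ℕ → Set
InReflectE m Y n = ∃ λ e → InE Y e × n + e ≡ m

IsLeast : (ℕ → Set) → ℕ → Set
IsLeast P m = P m × (∀ k → P k → m ≤ k)

Is-n : (b : ℕ) → .{{NonZero b}} → List ℕ → ℕ → ℕ → Set
Is-n b X c m = IsLeast (λ n → (n % b ≡ c % b) × InP X n) m

Is-N : List ℕ → ℕ → ℕ → Set
Is-N X nc M = IsLeast (λ N → InSumset X N nc) M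

{-# OPTIONS --safe #-}
-- Write n = n_{a,A} + k b, which is possible because n ∈ 𝒫(A) is ≡ a and n_{a,A} is least such,
-- and likewise N b − n = n_{b−a,b−A} + j b.  If N_{a,A} + k ≤ N, adding k copies of b ∈ A to a
-- representation of n_{a,A} (and padding with 0 ∈ A) puts n in NA.  Otherwise k is so large that
-- j + N_{b−a,b−A} ≤ N, and reflecting x ↦ b − x turns the representation of n_{b−a,b−A} into one of
-- N_{b−a,b−A} b − n_{b−a,b−A} in N_{b−a,b−A} A; adding N − j − N_{b−a,b−A} copies of b gives n.
module Submission where

open import Defs
open import Data.Nat using (ℕ; _+_; _*_; _∸_; _≤_; _<_; NonZero)
open import Data.Nat.DivMod using (_%_)
open import Data.List using (List)
open import Data.List.Relation.Unary.All using (All)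
open import Data.List.Membership.Propositional using (_∈_)
open import Data.Sum using (_⊎_)
open import Relation.Binary.PropositionalEquality using (_≡_)
open import Relation.Nullary using (¬_)

open import Data.Nat using (zero; suc; _/_; _≟_; _≤?_)
open import Data.Nat.Properties
open import Data.Nat.DivMod
  using (m≡m%n+[m/n]*n; /-mono-≤; [m+kn]%n≡m%n; %-distribˡ-+; m*n%n≡0; n%n≡0; m%n<n)
open import Data.Nat.Tactic.RingSolver using (solve-∀)
import Data.List.Relation.Unary.All as ListAll
open import Data.List.Relation.Unary.Any using (any?)
open import Data.List.Membership.Propositional using (find; lose)
open import Data.List.Membership.Propositional.Properties using (∈-map⁻)
open import Data.Vec using ([]; _∷_)
import Data.Vec as Vec
open import Data.Vec.Relation.Unary.All using ([]; _∷_)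
open import Data.Product using (Σ; _×_; _,_)
open import Data.Sum using (inj₁; inj₂)
open import Relation.Nullary using (Dec; yes; no)
open import Relation.Nullary.Decidable using (_×-dec_; decidable-stable)
open import Relation.Binary.PropositionalEquality
  using (refl; sym; trans; cong; cong₂; subst; subst₂; module ≡-Reasoning)

inSumset-0 : ∀ A → InSumset A 0 0
inSumset-0 A = [] , [] , refl

inSumset-∷ : ∀ {A K s x} → x ∈ A → InSumset A K s → InSumset A (suc K) (x + s)
inSumset-∷ x∈A (v , v⊆A , Σv≡s) = (_ ∷ v) , (x∈A ∷ v⊆A) , cong (_ +_) Σv≡s

inSumset-+* : ∀ {A K s b} → b ∈ A → (t : ℕ) → InSumset A K s → InSumset A (t + K) (t * b + s)
inSumset-+* b∈A zero S = S
inSumset-+* {A} {K} {s} {b} b∈A (suc t) S =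
  subst (InSumset A (suc (t + K))) (sym (+-assoc b (t * b) s)) (inSumset-∷ b∈A (inSumset-+* b∈A t S))

inSumset-mono : ∀ {A K N s} → 0 ∈ A → K ≤ N → InSumset A K s → InSumset A N s
inSumset-mono {A} {K} {N} {s} 0∈A K≤N S =
  subst₂ (InSumset A) (m∸n+n≡m K≤N) (cong (_+ s) (*-zeroʳ (N ∸ K))) (inSumset-+* 0∈A (N ∸ K) S)

inSumset-minusSet : ∀ {A K s b} → All (_≤ b) A → InSumset (minusSet b A) K s →
  Σ ℕ λ m → InSumset A K m × m + s ≡ K * b
inSumset-minusSet A≤b ([] , [] , refl) = 0 , inSumset-0 _ , refl
inSumset-minusSet {b = b} A≤b ((y ∷ w) , (y∈ ∷ w⊆) , refl) with ∈-map⁻ (b ∸_) y∈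
... | x , x∈A , refl with inSumset-minusSet A≤b (w , w⊆ , refl)
... | m , S , m+Σw≡Kb = x + m , inSumset-∷ x∈A S ,
  trans (regroup x m (b ∸ x) (Vec.sum w)) (cong₂ _+_ (m+[n∸m]≡n (ListAll.lookup A≤b x∈A)) m+Σw≡Kb)
  where
  regroup : ∀ x m y w → (x + m) + (y + w) ≡ (x + y) + (m + w)
  regroup = solve-∀

inSumset? : ∀ A K n → Dec (InSumset A K n)
inSumset? A zero n with n ≟ 0
... | yes refl = yes (inSumset-0 A)
... | no n≢0 = no λ { ([] , _ , 0≡n) → n≢0 (sym 0≡n) }
inSumset? A (suc K) n with any? (λ x → (x ≤? n) ×-dec inSumset? A K (n ∸ x)) A
... | yes found with find found
...   | x , x∈A , (x≤n , S) = yes (subst (InSumset A (suc K)) (m+[n∸m]≡n x≤n) (inSumset-∷ x∈A S))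
inSumset? A (suc K) n | no none = no λ { ((x ∷ v) , (x∈A ∷ v⊆A) , x+Σv≡n) →
  none (lose x∈A (subst (x ≤_) x+Σv≡n (m≤m+n x (Vec.sum v)) ,
                  (v , v⊆A , trans (sym (m+n∸m≡n x (Vec.sum v))) (cong (_∸ x) x+Σv≡n)))) }

module _ (b : ℕ) .{{_ : NonZero b}} where

  %-congˡ-+ : ∀ {u v} x → u % b ≡ v % b → (u + x) % b ≡ (v + x) % b
  %-congˡ-+ {u} {v} x u≡v = begin
    (u + x) % b           ≡⟨ %-distribˡ-+ u x b ⟩
    (u % b + x % b) % b   ≡⟨ cong (λ r → (r + x % b) % b) u≡v ⟩
    (v % b + x % b) % b   ≡⟨ sym (%-distribˡ-+ v x b) ⟩
    (v + x) % b           ∎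
    where open ≡-Reasoning

  %-cancelˡ-+ : ∀ a {x y} → (a + x) % b ≡ (a + y) % b → x % b ≡ y % b
  %-cancelˡ-+ a {x} {y} a+x≡a+y = begin
    x % b               ≡⟨ sym (complete x) ⟩
    (a + x + c) % b     ≡⟨ %-congˡ-+ c a+x≡a+y ⟩
    (a + y + c) % b     ≡⟨ complete y ⟩
    y % b               ∎
    where
    open ≡-Reasoning
    c = b ∸ a % b
    -- a + c ≡ (1 + a / b) * b
    c+a%b≡b : c + a % b ≡ b
    c+a%b≡b = m∸n+n≡m (<⇒≤ (m%n<n a b))
    regroup : ∀ r q z s d → (r + q * d) + z + s ≡ z + ((s + r) + q * d)
    regroup = solve-∀
    complete : ∀ z → (a + z + c) % b ≡ z % b
    complete z = begin
      (a + z + c) % b                   ≡⟨ cong (λ t → (t + z + c) % b) (m≡m%n+[m/n]*n a b) ⟩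
      ((a % b + a / b * b) + z + c) % b ≡⟨ cong (_% b) (regroup (a % b) (a / b) z c b) ⟩
      (z + ((c + a % b) + a / b * b)) % b ≡⟨ cong (λ t → (z + (t + a / b * b)) % b) c+a%b≡b ⟩
      (z + suc (a / b) * b) % b         ≡⟨ [m+kn]%n≡m%n z (suc (a / b)) b ⟩
      z % b                             ∎

  %-complement : ∀ {a n} N → a ≤ b → n % b ≡ a % b → n ≤ N * b → (N * b ∸ n) % b ≡ (b ∸ a) % b
  %-complement {a} {n} N a≤b n≡a n≤Nb = %-cancelˡ-+ a (begin
    (a + e) % b         ≡⟨ %-congˡ-+ e (sym n≡a) ⟩
    (n + e) % b         ≡⟨ cong (_% b) (m+[n∸m]≡n n≤Nb) ⟩
    (N * b) % b         ≡⟨ m*n%n≡0 N b ⟩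
    0                   ≡⟨ sym (n%n≡0 b) ⟩
    b % b               ≡⟨ cong (_% b) (sym (m+[n∸m]≡n a≤b)) ⟩
    (a + (b ∸ a)) % b   ∎)
    where
    open ≡-Reasoning
    e = N * b ∸ n

  m%n≡o%n∧o≤m⇒m≡o+q*n : ∀ {m o} → m % b ≡ o % b → o ≤ m → Σ ℕ λ q → m ≡ o + q * b
  m%n≡o%n∧o≤m⇒m≡o+q*n {m} {o} m≡o o≤m = q , (begin
    m                            ≡⟨ m≡m%n+[m/n]*n m b ⟩
    m % b + (m / b) * b          ≡⟨ cong₂ _+_ m≡o (cong (_* b) (sym (m+[n∸m]≡n o/b≤m/b))) ⟩
    o % b + (o / b + q) * b      ≡⟨ regroup (o % b) (o / b) q b ⟩
    (o % b + (o / b) * b) + q * b ≡⟨ cong (_+ q * b) (sym (m≡m%n+[m/n]*n o b)) ⟩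
    o + q * b                    ∎)
    where
    open ≡-Reasoning
    q = m / b ∸ o / b
    o/b≤m/b : o / b ≤ m / b
    o/b≤m/b = /-mono-≤ o≤m (≤-refl {b})
    regroup : ∀ r p q d → r + (p + q) * d ≡ (r + p * d) + q * d
    regroup = solve-∀

  Is-n⇒≡+* : ∀ {X c m x} → Is-n b X c m → x % b ≡ c % b → InP X x → Σ ℕ λ q → x ≡ m + q * b
  Is-n⇒≡+* ((m≡c , _) , least) x≡c x∈P = m%n≡o%n∧o≤m⇒m≡o+q*n (trans x≡c (sym m≡c)) (least _ (x≡c , x∈P))

k+j≤N : ∀ {na nb k j N} b .{{_ : NonZero b}} → (na + k * b) + (nb + j * b) ≡ N * b → k + j ≤ N
k+j≤N {na} {nb} {k} {j} {N} b sum≡Nb = *-cancelʳ-≤ (k + j) N b (begin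
  (k + j) * b                  ≡⟨ *-distribʳ-+ b k j ⟩
  k * b + j * b                ≤⟨ +-mono-≤ (m≤n+m (k * b) na) (m≤n+m (j * b) nb) ⟩
  (na + k * b) + (nb + j * b)  ≡⟨ sum≡Nb ⟩
  N * b                        ∎)
  where open ≤-Reasoning

j+Nb≤N : ∀ {k j N Na Nb} → k + j ≤ N → N < Na + k → Na + Nb ≤ N → j + Nb ≤ N
j+Nb≤N {k} {j} {N} {Na} {Nb} k+j≤N N<Na+k Na+Nb≤N = <⇒≤ (+-cancelˡ-< Na (j + Nb) N (begin-strict
  Na + (j + Nb)   ≡⟨ regroup Na j Nb ⟩
  Na + Nb + j     ≤⟨ +-monoˡ-≤ j Na+Nb≤N ⟩
  N + j           <⟨ +-monoˡ-< j N<Na+k ⟩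
  Na + k + j      ≡⟨ +-assoc Na k j ⟩
  Na + (k + j)    ≤⟨ +-monoʳ-≤ Na k+j≤N ⟩
  Na + N          ∎))
  where
  open ≤-Reasoning
  regroup : ∀ x y z → x + (y + z) ≡ x + z + y
  regroup = solve-∀

module _ {A : List ℕ} {b : ℕ} .{{_ : NonZero b}} (0∈A : 0 ∈ A) (b∈A : b ∈ A) (A≤b : All (_≤ b) A) where

  inSumset-split : ∀ {Na na Nb nb N n e} → InSumset A Na na → InSumset (minusSet b A) Nb nb →
    Na + Nb ≤ N → n + e ≡ N * b →
    (Σ ℕ λ k → n ≡ na + k * b) → (Σ ℕ λ j → e ≡ nb + j * b) → InSumset A N n
  inSumset-split {Na} {na} {Nb} {nb} {N} na∈ nb∈ Na+Nb≤N n+e≡Nb (k , refl) (j , refl) with Na + k ≤? N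
  ... | yes Na+k≤N = inSumset-mono 0∈A (subst (_≤ N) (+-comm Na k) Na+k≤N)
    (subst (InSumset A (k + Na)) (+-comm (k * b) na) (inSumset-+* b∈A k na∈))
  ... | no Na+k≰N with inSumset-minusSet A≤b nb∈
  ...   | m , m∈ , m+nb≡Nb*b = inSumset-mono 0∈A t+Nb≤N
    (subst (InSumset A (t + Nb)) (sym n≡tb+m) (inSumset-+* b∈A t m∈))
    where
    t = N ∸ (j + Nb)
    t+j+Nb≡N : t + (j + Nb) ≡ N
    t+j+Nb≡N = m∸n+n≡m (j+Nb≤N {k} (k+j≤N {na} {nb} {k} {j} {N} b n+e≡Nb) (≰⇒> Na+k≰N) Na+Nb≤N)
    t+Nb≤N : t + Nb ≤ N
    t+Nb≤N = subst (t + Nb ≤_) t+j+Nb≡N (+-monoʳ-≤ t (m≤n+m Nb j))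
    expand : ∀ t j N d → (t + (j + N)) * d ≡ t * d + (j * d + N * d)
    expand = solve-∀
    regroup : ∀ x y m nb → x + (y + (m + nb)) ≡ (x + m) + (nb + y)
    regroup = solve-∀
    n≡tb+m : na + k * b ≡ t * b + m
    n≡tb+m = +-cancelʳ-≡ (nb + j * b) (na + k * b) (t * b + m) (begin
      (na + k * b) + (nb + j * b)       ≡⟨ n+e≡Nb ⟩
      N * b                             ≡⟨ cong (_* b) (sym t+j+Nb≡N) ⟩
      (t + (j + Nb)) * b                ≡⟨ expand t j Nb b ⟩
      t * b + (j * b + Nb * b)          ≡⟨ cong (λ x → t * b + (j * b + x)) (sym m+nb≡Nb*b) ⟩
      t * b + (j * b + (m + nb))        ≡⟨ regroup (t * b) (j * b) m nb ⟩
      (t * b + m) + (nb + j * b)        ∎)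
      where open ≡-Reasoning

-- gcd A ≡ 1 only guarantees that n_{a,A} exists, and here n_{a,A} is given; 1 ≤ N is likewise unused.
mainTheorem8 : (A : List ℕ) (b : ℕ) .{{_ : NonZero b}}
    → 0 ∈ A → b ∈ A → All (_≤ b) A → gcdList A ≡ 1
    → (a : ℕ) → a < b
    → (na Na nb Nb : ℕ)
    → Is-n b A a na → Is-N A na Na
    → Is-n b (minusSet b A) (b ∸ a) nb → Is-N (minusSet b A) nb Nb
    → (N : ℕ) → 1 ≤ N → Na + Nb ≤ N
    → (n : ℕ) → n ≤ N * b → n % b ≡ a % b
    → ¬ (InE A n ⊎ InReflectE (N * b) (minusSet b A) n)
    → InSumset A N n
mainTheorem8 A b 0∈A b∈A A≤b _ a a<b na Na nb Nb na-least (na∈NaA , _) nb-least (nb∈Nb[b-A] , _)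
  N _ Na+Nb≤N n n≤Nb n≡a n∉E =
  -- the hypothesis only yields ¬¬ n ∈ 𝒫(A) and ¬¬ N b − n ∈ 𝒫(b − A); decidability of NA bridges the gap
  decidable-stable (inSumset? A N n) λ n∉NA →
    n∉E (inj₁ λ n∈P → n∉E (inj₂ (e , (λ e∈P → n∉NA (split n∈P e∈P)) , n+e≡Nb)))
  where
  e = N * b ∸ n
  n+e≡Nb : n + e ≡ N * b
  n+e≡Nb = m+[n∸m]≡n n≤Nb
  split : InP A n → InP (minusSet b A) e → InSumset A N n
  split n∈P e∈P = inSumset-split 0∈A b∈A A≤b na∈NaA nb∈Nb[b-A] Na+Nb≤N n+e≡Nb
    (Is-n⇒≡+* b na-least n≡a n∈P)
    (Is-n⇒≡+* b nb-least (%-complement b N (<⇒≤ a<b) n≡a n≤Nb) e∈P)
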